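{- For every $n\ge0$, $\#\mathrm{Av}_n([1243],[1324],[1423])=\#\mathrm{Av}_n([1324],[1342],[1423])$. Moreover, for $n\ge2$, $\#\mathrm{Av}_n([1324],[1342],[1423])=n-1$.
   Context: For a linear permutation $\pi=\pi_1\ldots\pi_n$ of $[n]$, the cyclic permutation $[\pi]$ is the set of all rotations of $\pi$. A linear permutation $\sigma$ contains $\pi$ if some subsequence of $\sigma$ is order isomorphic to $\pi$ (same relative order). A cyclic permutation $[\sigma]$ contains $[\pi]$ if some rotation of $\sigma$ contains $\pi$; otherwise it avoids $[\pi]$. For a set of cyclic patterns $[\Pi]$, $\mathrm{Av}_n[\Pi]$ denotes the set of cyclic permutations of length $n$ avoiding every pattern in $[\Pi]$. -}

module Defs where

open import Data.Bool using (Bool; true; false; _∧_; _∨_; not)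
open import Data.Nat using (ℕ; zero; suc; _<ᵇ_; _≡ᵇ_)
open import Data.List using (List; []; _∷_; _++_; map; concatMap; length; filter; deduplicateᵇ; upTo)
open import Data.Bool.ListAction using (any; all)
open import Relation.Nullary.Decidable using (T?)

-- Linear permutations of [n] are represented as lists of naturals
-- (a permutation of 0,…,n-1 in one-line notation).  Pattern containment
-- only depends on relative order, so patterns may be written 1-based.

insertions : ℕ → List ℕ → List (List ℕ)
insertions x [] = (x ∷ []) ∷ []
insertions x (y ∷ ys) = (x ∷ y ∷ ys) ∷ map (y ∷_) (insertions x ys)

perms : ℕ → List (List ℕ)
perms zero = [] ∷ []
perms (suc n) = concatMap (insertions n) (perms n)

subseqs : List ℕ → List (List ℕ)
subseqs [] = [] ∷ []
subseqs (x ∷ xs) = map (x ∷_) (subseqs xs) ++ subseqs xs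

sameOrderWith : ℕ → ℕ → List ℕ → List ℕ → Bool
sameOrderWith a b [] [] = true
sameOrderWith a b (c ∷ as) (d ∷ bs) =
  ((a <ᵇ c) ≡ᵇᵇ (b <ᵇ d)) ∧ sameOrderWith a b as bs
  where
  _≡ᵇᵇ_ : Bool → Bool → Bool
  true ≡ᵇᵇ y = y
  false ≡ᵇᵇ y = not y
sameOrderWith a b _ _ = false

orderIso : List ℕ → List ℕ → Bool
orderIso [] [] = true
orderIso (a ∷ as) (b ∷ bs) = sameOrderWith a b as bs ∧ orderIso as bs
orderIso _ _ = false

containsLin : List ℕ → List ℕ → Bool
containsLin σ π = any (λ τ → orderIso τ π) (subseqs σ)

rotate1 : List ℕ → List ℕ
rotate1 [] = []
rotate1 (x ∷ xs) = xs ++ (x ∷ [])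

iterRot : ℕ → List ℕ → List ℕ
iterRot zero xs = xs
iterRot (suc k) xs = iterRot k (rotate1 xs)

rotations : List ℕ → List (List ℕ)
rotations σ = map (λ k → iterRot k σ) (upTo (length σ))

containsCyc : List ℕ → List ℕ → Bool
containsCyc σ π = any (λ τ → containsLin τ π) (rotations σ)

avoidsAll : List (List ℕ) → List ℕ → Bool
avoidsAll Π σ = all (λ π → not (containsCyc σ π)) Π

eqList : List ℕ → List ℕ → Bool
eqList [] [] = true
eqList (x ∷ xs) (y ∷ ys) = (x ≡ᵇ y) ∧ eqList xs ys
eqList _ _ = false

sameCycle : List ℕ → List ℕ → Bool
sameCycle σ τ = any (eqList τ) (rotations σ)

-- #Av_n[Π]: the number of cyclic permutations of length n (= rotation classes
-- of linear permutations of [n]) avoiding every pattern of Π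
numAv : List (List ℕ) → ℕ → ℕ
numAv Π n = length (deduplicateᵇ sameCycle (filter (λ σ → T? (avoidsAll Π σ)) (perms n)))

-- Rotate a cyclic permutation of [n] so that its maximum M = n − 1 comes first. An occurrence
-- of [1324], [1342] or [1423] in [M w] either avoids M, and is then an occurrence in [w], or
-- uses M as its 4, and then the other three entries form a 132, 213 or 231 in w. Hence if [M w]
-- avoids the three patterns, w avoids 132, 213 and 231; the permutations of [m] (m = n − 1)
-- doing so are exactly the m staircases m−1, …, m−j, 0, 1, …, m−j−1 (j < m), and conversely
-- each staircase, with M in front, avoids the patterns by induction on m. So there are n − 1
-- classes. Reversal maps [1243], [1324], [1423] to [1342], [1423], [1324], hence is a bijection
-- between the two avoidance classes.

module Submission where

open import Defs

open import Data.Nat using (ℕ; zero; suc; _∸_; _<ᵇ_; _≡ᵇ_; _<_; _≤_; z≤n; s≤s; s<s⁻¹; s≤s⁻¹; _≟_)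
open import Relation.Binary.PropositionalEquality
  using (_≡_; _≢_; ≢-sym; refl; sym; trans; cong; cong₂; subst; subst₂; setoid; module ≡-Reasoning)
open import Data.Bool using (Bool; true; false; not; T; if_then_else_)
open import Data.Bool.Properties using (T-≡; T-∧)
open import Data.Empty using (⊥; ⊥-elim)
open import Data.List using (List; []; _∷_; _++_; [_]; applyUpTo; map; length; reverse; filter; upTo; deduplicateᵇ)
open import Data.List.Properties
  using (++-assoc; ++-identityʳ; ∷-injective; ∷-injectiveʳ; reverse-++; length-++; upTo-∷ʳ; length-upTo; length-map; reverse-involutive)
open import Data.List.Membership.Propositional using (_∈_; find; lose)
open import Data.List.Membership.Propositional.Properties
  using (∈-map⁺; ∈-map⁻; ∈-++⁺ˡ; ∈-++⁺ʳ; ∈-++⁻; ∈-upTo⁺; ∈-upTo⁻; ∈-applyUpTo⁻; ∈-∃++; ∈-concatMap⁺; ∈-concatMap⁻; ∈-filter⁺; ∈-filter⁻; ∈-deduplicate⁻)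
open import Data.List.Membership.Propositional.Properties.WithK using (unique∧set⇒bag)
open import Data.List.Relation.Unary.Any using (here; there)
open import Data.List.Relation.Unary.Any.Properties as AnyP using (any⁺; any⁻)
open import Data.List.Relation.Unary.All as All using (All; []; _∷_)
open import Data.List.Relation.Unary.Unique.Propositional using (Unique; []; _∷_)
open import Data.List.Relation.Unary.Unique.Propositional.Properties using (upTo⁺)
open import Data.List.Relation.Binary.Sublist.Propositional {A = ℕ}
  using (_⊆_; []; _∷_; _∷ʳ_; lookup; ⊆-refl; ⊆-trans; from∈; to∈; minimum)
open import Data.List.Relation.Binary.Sublist.Propositional.Properties
  using (length-mono-≤; All-resp-⊆; filter-⊆; ∷ˡ⁻)
  renaming (reverse⁺ to ⊆-reverse⁺; ++⁺ to ⊆-++⁺; map⁺ to ⊆-map⁺; ++⁺ˡ to ⊆-++⁺ˡ; ++⁺ʳ to ⊆-++⁺ʳ)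
open import Data.List.Relation.Binary.Permutation.Propositional
  using (_↭_; ↭-refl; ↭-sym; ↭-trans; ↭-reflexive; prep; ↭⇒↭ₛ)
open import Data.List.Relation.Binary.Permutation.Propositional.Properties
  using (↭-length; ++-comm; shift; drop-mid; ∷↭∷ʳ; ∈-resp-↭; ↭-empty-inv; ↭-singleton-inv; ↭-reverse)
open import Data.List.Relation.Binary.Permutation.Setoid.Properties (setoid ℕ) using (Unique-resp-↭)
open import Data.List.Relation.Binary.BagAndSetEquality using (_∼[_]_; bag; ∼bag⇒↭)
open import Data.Nat.Properties
  using (<ᵇ⇒<; <⇒<ᵇ; ≡ᵇ⇒≡; ≡⇒≡ᵇ; ≮⇒≥; <⇒≱; <⇒≤; <⇒≢; n<1+n; m<m+n; n≢0⇒n>0; ≤∧≢⇒<; ≤-reflexive; ≤-antisym; ≤-trans; <-trans; <-asym; <-≤-trans; ≤-<-trans)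
open import Data.Product using (∃; ∃₂; ∃-syntax; _×_; _,_; proj₁)
open import Data.Sum using (_⊎_; inj₁; inj₂)
open import Data.Unit using (⊤; tt)
open import Function using (id; _∘_; _∘₂_; _⇔_; Equivalence; mk⇔)
open import Relation.Nullary using (¬_; ¬?; yes; no)
open import Relation.Nullary.Decidable using (T?)

-- Order isomorphism

<ᵇ≡true⇒< : ∀ {a b} → (a <ᵇ b) ≡ true → a < b
<ᵇ≡true⇒< {a} {b} e = <ᵇ⇒< a b (Equivalence.from T-≡ e)

<ᵇ≡false⇒≥ : ∀ {a b} → (a <ᵇ b) ≡ false → b ≤ a
<ᵇ≡false⇒≥ e = ≮⇒≥ (λ a<b → subst T e (<⇒<ᵇ a<b))

<⇒<ᵇ≡true : ∀ {a b} → a < b → (a <ᵇ b) ≡ true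
<⇒<ᵇ≡true a<b = Equivalence.to T-≡ (<⇒<ᵇ a<b)

≥⇒<ᵇ≡false : ∀ {a b} → b ≤ a → (a <ᵇ b) ≡ false
≥⇒<ᵇ≡false {a} {b} b≤a with a <ᵇ b in e
... | false = refl
... | true = ⊥-elim (<⇒≱ (<ᵇ≡true⇒< e) b≤a)

SameOrderWith : ℕ → ℕ → List ℕ → List ℕ → Set
SameOrderWith a b [] [] = ⊤
SameOrderWith a b (c ∷ cs) (d ∷ ds) = (a <ᵇ c) ≡ (b <ᵇ d) × SameOrderWith a b cs ds
SameOrderWith a b _ _ = ⊥

OrderIso : List ℕ → List ℕ → Set
OrderIso [] [] = ⊤
OrderIso (a ∷ as) (b ∷ bs) = SameOrderWith a b as bs × OrderIso as bs
OrderIso _ _ = ⊥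

sameOrderWith⇒SameOrderWith : ∀ a b cs ds → T (sameOrderWith a b cs ds) → SameOrderWith a b cs ds
sameOrderWith⇒SameOrderWith a b [] [] _ = tt
sameOrderWith⇒SameOrderWith a b (c ∷ cs) (d ∷ ds) t with a <ᵇ c | b <ᵇ d
... | true  | true  = refl , sameOrderWith⇒SameOrderWith a b cs ds t
... | false | false = refl , sameOrderWith⇒SameOrderWith a b cs ds t

SameOrderWith⇒sameOrderWith : ∀ a b cs ds → SameOrderWith a b cs ds → T (sameOrderWith a b cs ds)
SameOrderWith⇒sameOrderWith a b [] [] _ = tt
SameOrderWith⇒sameOrderWith a b (c ∷ cs) (d ∷ ds) (e , s) with a <ᵇ c | b <ᵇ d | e
... | true  | .true  | refl = SameOrderWith⇒sameOrderWith a b cs ds s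
... | false | .false | refl = SameOrderWith⇒sameOrderWith a b cs ds s

orderIso⇒OrderIso : ∀ as bs → T (orderIso as bs) → OrderIso as bs
orderIso⇒OrderIso [] [] _ = tt
orderIso⇒OrderIso (a ∷ as) (b ∷ bs) t with Equivalence.to (T-∧ {sameOrderWith a b as bs}) t
... | s , i = sameOrderWith⇒SameOrderWith a b as bs s , orderIso⇒OrderIso as bs i

OrderIso⇒orderIso : ∀ as bs → OrderIso as bs → T (orderIso as bs)
OrderIso⇒orderIso [] [] _ = tt
OrderIso⇒orderIso (a ∷ as) (b ∷ bs) (s , i) =
  Equivalence.from T-∧ (SameOrderWith⇒sameOrderWith a b as bs s , OrderIso⇒orderIso as bs i)

-- Rotations and cyclic containment

⊆-++-split : ∀ a {b xs} → xs ⊆ a ++ b → ∃₂ λ xa xb → xs ≡ xa ++ xb × xa ⊆ a × xb ⊆ b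
⊆-++-split [] p = [] , _ , refl , [] , p
⊆-++-split (y ∷ a) (_ ∷ʳ p) with ⊆-++-split a p
... | xa , xb , refl , pa , pb = xa , xb , refl , y ∷ʳ pa , pb
⊆-++-split (y ∷ a) (refl ∷ p) with ⊆-++-split a p
... | xa , xb , refl , pa , pb = y ∷ xa , xb , refl , refl ∷ pa , pb

++-⊆-split : ∀ xa {xb ys} → xa ++ xb ⊆ ys → ∃₂ λ a b → ys ≡ a ++ b × xa ⊆ a × xb ⊆ b
++-⊆-split [] {ys = ys} p = [] , ys , refl , [] , p
++-⊆-split (x ∷ xa) (y ∷ʳ p) with ++-⊆-split (x ∷ xa) p
... | a , b , refl , pa , pb = y ∷ a , b , refl , y ∷ʳ pa , pb
++-⊆-split (x ∷ xa) (refl ∷ p) with ++-⊆-split xa p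
... | a , b , refl , pa , pb = x ∷ a , b , refl , refl ∷ pa , pb

infix 4 _↻_
_↻_ : List ℕ → List ℕ → Set
σ ↻ τ = ∃₂ λ a b → σ ≡ a ++ b × τ ≡ b ++ a

↻-refl : ∀ σ → σ ↻ σ
↻-refl σ = [] , σ , refl , sym (++-identityʳ σ)

↻-sym : ∀ {σ τ} → σ ↻ τ → τ ↻ σ
↻-sym (a , b , e₁ , e₂) = b , a , e₂ , e₁

++-≡-++-split : ∀ (a b c d : List ℕ) → a ++ b ≡ c ++ d →
  (∃ λ m → c ≡ a ++ m × b ≡ m ++ d) ⊎ (∃ λ m → a ≡ c ++ m × d ≡ m ++ b)
++-≡-++-split [] b c d e = inj₁ (c , refl , e)
++-≡-++-split (x ∷ a) b [] d e = inj₂ (x ∷ a , refl , sym e)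
++-≡-++-split (x ∷ a) b (y ∷ c) d e with ∷-injective e
... | refl , e′ with ++-≡-++-split a b c d e′
...   | inj₁ (m , refl , refl) = inj₁ (m , refl , refl)
...   | inj₂ (m , refl , refl) = inj₂ (m , refl , refl)

↻-trans : ∀ {σ τ ρ} → σ ↻ τ → τ ↻ ρ → σ ↻ ρ
↻-trans (a , b , refl , e) (c , d , e′ , refl) with ++-≡-++-split b a c d (trans (sym e) e′)
... | inj₁ (m , refl , refl) = m , d ++ b , ++-assoc m d b , sym (++-assoc d b m)
... | inj₂ (m , refl , refl) = a ++ c , m , sym (++-assoc a c m) , ++-assoc m a c

↻-reverse : ∀ {σ τ} → σ ↻ τ → reverse σ ↻ reverse τ
↻-reverse (a , b , refl , refl) = reverse b , reverse a , reverse-++ a b , reverse-++ b a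

↻-reverse⁻ : ∀ {σ τ} → reverse σ ↻ reverse τ → σ ↻ τ
↻-reverse⁻ {σ} {τ} r = subst₂ _↻_ (reverse-involutive σ) (reverse-involutive τ) (↻-reverse r)

↻⇒↭ : ∀ {σ τ} → σ ↻ τ → σ ↭ τ
↻⇒↭ (a , b , refl , refl) = ++-comm a b

↻-length : ∀ {σ τ} → σ ↻ τ → length σ ≡ length τ
↻-length σ↻τ = ↭-length (↻⇒↭ σ↻τ)

iterRot-↻ : ∀ k σ → σ ↻ iterRot k σ
iterRot-↻ zero σ = ↻-refl σ
iterRot-↻ (suc k) [] = iterRot-↻ k []
iterRot-↻ (suc k) (x ∷ σ) = ↻-trans (x ∷ [] , σ , refl , refl) (iterRot-↻ k (σ ++ x ∷ []))

iterRot-++ : ∀ a b → iterRot (length a) (a ++ b) ≡ b ++ a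
iterRot-++ [] b = sym (++-identityʳ b)
iterRot-++ (x ∷ a) b = begin
  iterRot (length a) ((a ++ b) ++ x ∷ []) ≡⟨ cong (iterRot (length a)) (++-assoc a b (x ∷ [])) ⟩
  iterRot (length a) (a ++ b ++ x ∷ [])   ≡⟨ iterRot-++ a (b ++ x ∷ []) ⟩
  (b ++ x ∷ []) ++ a                      ≡⟨ ++-assoc b (x ∷ []) a ⟩
  b ++ x ∷ a                              ∎
  where open ≡-Reasoning

rotations⁻ : ∀ {σ τ} → τ ∈ rotations σ → σ ↻ τ
rotations⁻ {σ} τ∈ with ∈-map⁻ (λ k → iterRot k σ) τ∈
... | k , _ , refl = iterRot-↻ k σ

rotations⁺ : ∀ {σ τ} → σ ↻ τ → 0 < length σ → τ ∈ rotations σ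
rotations⁺ (a , [] , refl , refl) 0<∣a∣ =
  subst (_∈ rotations (a ++ [])) (++-identityʳ a) (∈-map⁺ (λ k → iterRot k (a ++ [])) (∈-upTo⁺ 0<∣a∣))
rotations⁺ (a , y ∷ b , refl , refl) _ =
  subst (_∈ rotations (a ++ y ∷ b)) (iterRot-++ a (y ∷ b))
    (∈-map⁺ (λ k → iterRot k (a ++ y ∷ b)) (∈-upTo⁺ ∣a∣<∣a++y∷b∣))
  where
  ∣a∣<∣a++y∷b∣ : length a < length (a ++ y ∷ b)
  ∣a∣<∣a++y∷b∣ = subst (length a <_) (sym (length-++ a)) (m<m+n (length a) (s≤s z≤n))

subseqs⁻ : ∀ σ {s} → s ∈ subseqs σ → s ⊆ σ
subseqs⁻ [] (here refl) = []
subseqs⁻ (x ∷ σ) s∈ with ∈-++⁻ (map (x ∷_) (subseqs σ)) s∈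
... | inj₂ s∈′ = x ∷ʳ subseqs⁻ σ s∈′
... | inj₁ s∈′ with ∈-map⁻ (x ∷_) s∈′
...   | t , t∈ , refl = refl ∷ subseqs⁻ σ t∈

subseqs⁺ : ∀ {s σ} → s ⊆ σ → s ∈ subseqs σ
subseqs⁺ [] = here refl
subseqs⁺ {σ = y ∷ σ} (_ ∷ʳ p) = ∈-++⁺ʳ (map (y ∷_) (subseqs σ)) (subseqs⁺ p)
subseqs⁺ (refl ∷ p) = ∈-++⁺ˡ (∈-map⁺ _ (subseqs⁺ p))

CycContains : List ℕ → List ℕ → Set
CycContains σ π = ∃₂ λ X Y → X ⊆ σ × X ↻ Y × T (orderIso Y π)

Avoids : List (List ℕ) → List ℕ → Set
Avoids Π σ = All (λ π → ¬ CycContains σ π) Π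

CycContains-↻ : ∀ {σ σ′ π} → σ ↻ σ′ → CycContains σ π → CycContains σ′ π
CycContains-↻ (a , b , refl , refl) (X , Y , X⊆ , X↻Y , t) with ⊆-++-split a X⊆
... | xa , xb , refl , pa , pb = xb ++ xa , Y , ⊆-++⁺ pb pa , ↻-trans (xb , xa , refl , refl) X↻Y , t

orderIso-nonempty : ∀ Y {π} → π ≢ [] → T (orderIso Y π) → 0 < length Y
orderIso-nonempty [] {[]} π≢[] _ = ⊥-elim (π≢[] refl)
orderIso-nonempty (y ∷ Y) _ _ = s≤s z≤n

containsCyc⇒CycContains : ∀ σ π → T (containsCyc σ π) → CycContains σ π
containsCyc⇒CycContains σ π t with find (any⁻ _ (rotations σ) t)
... | τ , τ∈ , tτ with rotations⁻ τ∈ | find (any⁻ _ (subseqs τ) tτ)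
...   | a , b , refl , refl | s , s∈ , ts with ⊆-++-split b (subseqs⁻ _ s∈)
...     | sb , sa , refl , pb , pa = sa ++ sb , sb ++ sa , ⊆-++⁺ pa pb , (sa , sb , refl , refl) , ts

CycContains⇒containsCyc : ∀ σ {π} → π ≢ [] → CycContains σ π → T (containsCyc σ π)
CycContains⇒containsCyc σ {π} π≢[] (X , Y , X⊆σ , (a , b , refl , refl) , t) with ++-⊆-split a X⊆σ
... | s , u , refl , a⊆s , b⊆u =
  any⁺ _ (lose (rotations⁺ (s , u , refl , refl) 0<∣σ∣) (any⁺ _ (lose (subseqs⁺ (⊆-++⁺ b⊆u a⊆s)) t)))
  where
  0<∣σ∣ : 0 < length (s ++ u)
  0<∣σ∣ = <-≤-trans (orderIso-nonempty Y π≢[] t)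
            (≤-trans (≤-reflexive (↭-length (++-comm b a))) (length-mono-≤ X⊆σ))

T-not⇒¬T : ∀ {b} → T (not b) → ¬ T b
T-not⇒¬T {false} _ ()

¬T⇒T-not : ∀ {b} → ¬ T b → T (not b)
¬T⇒T-not {false} _ = tt
¬T⇒T-not {true} ¬t = ¬t tt

avoidsAll⇒Avoids : ∀ σ {Π} → All (_≢ []) Π → T (avoidsAll Π σ) → Avoids Π σ
avoidsAll⇒Avoids σ [] _ = []
avoidsAll⇒Avoids σ {π ∷ Π} (π≢[] ∷ Π≢[]) t with Equivalence.to (T-∧ {not (containsCyc σ π)}) t
... | t₁ , t₂ = (λ c → T-not⇒¬T t₁ (CycContains⇒containsCyc σ π≢[] c)) ∷ avoidsAll⇒Avoids σ Π≢[] t₂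

Avoids⇒avoidsAll : ∀ σ {Π} → Avoids Π σ → T (avoidsAll Π σ)
Avoids⇒avoidsAll σ [] = tt
Avoids⇒avoidsAll σ {π ∷ Π} (¬c ∷ ¬cs) =
  Equivalence.from T-∧ (¬T⇒T-not (λ t → ¬c (containsCyc⇒CycContains σ π t)) , Avoids⇒avoidsAll σ ¬cs)

-- Permutations of [n]

IsPerm : ℕ → List ℕ → Set
IsPerm n σ = σ ↭ upTo n

IsPerm-length : ∀ {n σ} → IsPerm n σ → length σ ≡ n
IsPerm-length {n} σ↭ = trans (↭-length σ↭) (length-upTo n)

IsPerm⇒Unique : ∀ {n σ} → IsPerm n σ → Unique σ
IsPerm⇒Unique {n} σ↭ = Unique-resp-↭ (↭⇒↭ₛ (↭-sym σ↭)) (upTo⁺ n)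

IsPerm-< : ∀ {n σ v} → IsPerm n σ → v ∈ σ → v < n
IsPerm-< σ↭ v∈ = ∈-upTo⁻ (∈-resp-↭ σ↭ v∈)

IsPerm-max∷ : ∀ {n σ} → IsPerm n σ → IsPerm (suc n) (n ∷ σ)
IsPerm-max∷ {n} σ↭ = ↭-trans (prep n σ↭) (↭-trans (∷↭∷ʳ n (upTo n)) (↭-reflexive (upTo-∷ʳ n)))

IsPerm-delete-max : ∀ n a {b} → IsPerm (suc n) (a ++ n ∷ b) → IsPerm n (a ++ b)
IsPerm-delete-max n a {b} σ↭ = subst (a ++ b ↭_) (++-identityʳ (upTo n))
  (drop-mid a (upTo n) (↭-trans σ↭ (↭-reflexive (sym (upTo-∷ʳ n)))))

IsPerm-↻ : ∀ {n σ τ} → σ ↻ τ → IsPerm n σ → IsPerm n τ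
IsPerm-↻ σ↻τ σ↭ = ↭-trans (↭-sym (↻⇒↭ σ↻τ)) σ↭

IsPerm-reverse : ∀ {n σ} → IsPerm n σ → IsPerm n (reverse σ)
IsPerm-reverse {σ = σ} σ↭ = ↭-trans (↭-reverse σ) σ↭

Unique-⊆ : ∀ {xs ys} → xs ⊆ ys → Unique ys → Unique xs
Unique-⊆ [] [] = []
Unique-⊆ (_ ∷ʳ p) (_ ∷ u) = Unique-⊆ p u
Unique-⊆ (refl ∷ p) (x≢ys ∷ u) = All-resp-⊆ p x≢ys ∷ Unique-⊆ p u

insertions⁻ : ∀ x ρ {σ} → σ ∈ insertions x ρ → ∃₂ λ a b → ρ ≡ a ++ b × σ ≡ a ++ x ∷ b
insertions⁻ x [] (here refl) = [] , [] , refl , refl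
insertions⁻ x (y ∷ ρ) (here refl) = [] , y ∷ ρ , refl , refl
insertions⁻ x (y ∷ ρ) (there σ∈) with ∈-map⁻ (y ∷_) σ∈
... | τ , τ∈ , refl with insertions⁻ x ρ τ∈
...   | a , b , refl , refl = y ∷ a , b , refl , refl

insertions⁺ : ∀ x a b → a ++ x ∷ b ∈ insertions x (a ++ b)
insertions⁺ x [] [] = here refl
insertions⁺ x [] (y ∷ b) = here refl
insertions⁺ x (y ∷ a) b = there (∈-map⁺ (y ∷_) (insertions⁺ x a b))

perms⁻ : ∀ n {σ} → σ ∈ perms n → IsPerm n σ
perms⁻ zero (here refl) = ↭-refl
perms⁻ (suc n) σ∈ with find (∈-concatMap⁻ (insertions n) {xs = perms n} σ∈)
... | ρ , ρ∈ , σ∈′ with insertions⁻ n ρ σ∈′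
...   | a , b , refl , refl = ↭-trans (shift n a b) (IsPerm-max∷ (perms⁻ n ρ∈))

perms⁺ : ∀ n {σ} → IsPerm n σ → σ ∈ perms n
perms⁺ zero σ↭ rewrite ↭-empty-inv σ↭ = here refl
perms⁺ (suc n) σ↭ with ∈-∃++ (∈-resp-↭ (↭-sym σ↭) (∈-upTo⁺ (n<1+n n)))
... | a , b , refl = ∈-concatMap⁺ (insertions n) (lose (perms⁺ n (IsPerm-delete-max n a σ↭)) (insertions⁺ n a b))

-- Counting rotation classes

eqList⇒≡ : ∀ xs ys → T (eqList xs ys) → xs ≡ ys
eqList⇒≡ [] [] _ = refl
eqList⇒≡ (x ∷ xs) (y ∷ ys) t with Equivalence.to (T-∧ {x ≡ᵇ y}) t
... | x≡ᵇy , t′ = cong₂ _∷_ (≡ᵇ⇒≡ x y x≡ᵇy) (eqList⇒≡ xs ys t′)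

eqList-refl : ∀ xs → T (eqList xs xs)
eqList-refl [] = tt
eqList-refl (x ∷ xs) = Equivalence.from T-∧ (≡⇒≡ᵇ x x refl , eqList-refl xs)

sameCycle⇒↻ : ∀ σ τ → T (sameCycle σ τ) → σ ↻ τ
sameCycle⇒↻ σ τ t with find (any⁻ (eqList τ) (rotations σ) t)
... | ρ , ρ∈ , e rewrite eqList⇒≡ τ ρ e = rotations⁻ ρ∈

sameCycle⇒nonempty : ∀ σ τ → T (sameCycle σ τ) → 0 < length σ
sameCycle⇒nonempty (x ∷ σ) τ _ = s≤s z≤n

↻⇒sameCycle : ∀ {σ τ} → σ ↻ τ → 0 < length σ → T (sameCycle σ τ)
↻⇒sameCycle {σ} {τ} σ↻τ 0<∣σ∣ = any⁺ (eqList τ) (lose (rotations⁺ σ↻τ 0<∣σ∣) (eqList-refl τ))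

-- The least j < m with T (f j), and m if there is none.
least : (ℕ → Bool) → ℕ → ℕ
least f zero = zero
least f (suc m) = if f 0 then 0 else suc (least (f ∘ suc) m)

least-≤ : ∀ f m {j} → j < m → T (f j) → least f m ≤ j
least-≤ f (suc m) {j} j<m t with f 0 in e
... | true = z≤n
least-≤ f (suc m) {zero} j<m t | false = ⊥-elim (subst T e t)
least-≤ f (suc m) {suc j} (s≤s j<m) t | false = s≤s (least-≤ (f ∘ suc) m j<m t)

least-holds : ∀ f m → least f m < m → T (f (least f m))
least-holds f (suc m) l<m with f 0 in e
... | true = subst T (sym e) tt
... | false = least-holds (f ∘ suc) m (s<s⁻¹ l<m)

least-cong : ∀ f g m → (∀ j → T (f j) ⇔ T (g j)) → least f m ≡ least g m
least-cong f g zero _ = refl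
least-cong f g (suc m) f⇔g with f 0 in e₁ | g 0 in e₂
... | true  | true  = refl
... | false | false = cong suc (least-cong (f ∘ suc) (g ∘ suc) m (f⇔g ∘ suc))
... | true  | false = ⊥-elim (subst T e₂ (Equivalence.to (f⇔g 0) (subst T (sym e₁) tt)))
... | false | true  = ⊥-elim (subst T e₁ (Equivalence.from (f⇔g 0) (subst T (sym e₂) tt)))

module _ {A : Set} (r : A → A → Bool) (cls : A → ℕ) where

  Unique-map-deduplicateᵇ : ∀ xs → (∀ {x y} → x ∈ xs → y ∈ xs → cls x ≡ cls y → T (r x y)) →
    Unique (map cls (deduplicateᵇ r xs))
  Unique-map-deduplicateᵇ [] _ = []
  Unique-map-deduplicateᵇ (x ∷ xs) cls⇒r =
    All.tabulate cls[x]≢ ∷ Unique-⊆ (⊆-map⁺ cls (filter-⊆ _ (deduplicateᵇ r xs)))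
                                    (Unique-map-deduplicateᵇ xs (λ x∈ y∈ → cls⇒r (there x∈) (there y∈)))
    where
    cls[x]≢ : ∀ {c} → c ∈ map cls (filter (λ y → ¬? (T? (r x y))) (deduplicateᵇ r xs)) → cls x ≢ c
    cls[x]≢ c∈ with ∈-map⁻ cls c∈
    ... | y , y∈ , refl with ∈-filter⁻ (λ y → ¬? (T? (r x y))) {xs = deduplicateᵇ r xs} y∈
    ...   | y∈D , ¬rxy = λ e → ¬rxy (cls⇒r (here refl) (there (∈-deduplicate⁻ _ xs y∈D)) e)

  length-deduplicateᵇ : ∀ xs m →
    (∀ {x y} → T (r x y) → cls x ≡ cls y) →
    (∀ {x y} → x ∈ xs → y ∈ xs → cls x ≡ cls y → T (r x y)) →
    (∀ {x} → x ∈ xs → cls x < m) →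
    (∀ {j} → j < m → ∃ λ x → x ∈ xs × cls x ≡ j) →
    length (deduplicateᵇ r xs) ≡ m
  length-deduplicateᵇ xs m r⇒cls cls⇒r cls<m onto = begin
    length D             ≡⟨ sym (length-map cls D) ⟩
    length (map cls D)   ≡⟨ ↭-length (∼bag⇒↭ map-cls-D∼upTo) ⟩
    length (upTo m)      ≡⟨ length-upTo m ⟩
    m                    ∎
    where
    open ≡-Reasoning
    D : List A
    D = deduplicateᵇ r xs
    to : ∀ {c} → c ∈ map cls D → c ∈ upTo m
    to c∈ with ∈-map⁻ cls c∈
    ... | y , y∈ , refl = ∈-upTo⁺ (cls<m (∈-deduplicate⁻ _ xs y∈))
    from : ∀ {c} → c ∈ upTo m → c ∈ map cls D
    from c∈ with onto (∈-upTo⁻ c∈)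
    ... | x , x∈ , refl with find (AnyP.deduplicate⁺ (T? ∘₂ r) (λ ryz e → trans (r⇒cls ryz) e) (lose x∈ refl))
    ...   | y , y∈ , e = subst (_∈ map cls D) e (∈-map⁺ cls y∈)
    map-cls-D∼upTo : map cls D ∼[ bag ] upTo m
    map-cls-D∼upTo = unique∧set⇒bag (Unique-map-deduplicateᵇ xs cls⇒r) (upTo⁺ m) (mk⇔ to from)

numAv-representatives : ∀ Π n m (Rep : ℕ → List ℕ) → All (_≢ []) Π → 0 < n →
  (∀ {j} → j < m → IsPerm n (Rep j) × Avoids Π (Rep j)) →
  (∀ {σ} → IsPerm n σ → Avoids Π σ → ∃ λ j → j < m × σ ↻ Rep j) →
  (∀ {j k} → j < m → k < m → Rep j ↻ Rep k → j ≡ k) →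
  numAv Π n ≡ m
numAv-representatives Π n m Rep Π≢[] 0<n Rep-avoids covered distinct =
  length-deduplicateᵇ sameCycle cls avoiders m
    (λ {σ} {τ} → sameCycle⇒cls {σ} {τ}) cls⇒sameCycle (proj₁ ∘ classify) onto
  where
  avoiders : List (List ℕ)
  avoiders = filter (λ σ → T? (avoidsAll Π σ)) (perms n)

  ∈avoiders⁻ : ∀ {σ} → σ ∈ avoiders → IsPerm n σ × Avoids Π σ
  ∈avoiders⁻ {σ} σ∈ with ∈-filter⁻ (λ σ → T? (avoidsAll Π σ)) {xs = perms n} σ∈
  ... | σ∈perms , t = perms⁻ n σ∈perms , avoidsAll⇒Avoids σ Π≢[] t

  ∈avoiders⁺ : ∀ {σ} → IsPerm n σ → Avoids Π σ → σ ∈ avoiders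
  ∈avoiders⁺ {σ} p a = ∈-filter⁺ (λ σ → T? (avoidsAll Π σ)) (perms⁺ n p) (Avoids⇒avoidsAll σ a)

  nonempty : ∀ {σ} → IsPerm n σ → 0 < length σ
  nonempty p = subst (0 <_) (sym (IsPerm-length p)) 0<n

  cls : List ℕ → ℕ
  cls σ = least (λ j → sameCycle σ (Rep j)) m

  least-class : ∀ {σ j} → j < m → 0 < length σ → σ ↻ Rep j → cls σ < m × σ ↻ Rep (cls σ)
  least-class {σ} j<m 0<∣σ∣ σ↻ =
    cls<m , sameCycle⇒↻ σ (Rep (cls σ)) (least-holds (λ j → sameCycle σ (Rep j)) m cls<m)
    where
    cls<m : cls σ < m
    cls<m = ≤-<-trans (least-≤ (λ j → sameCycle σ (Rep j)) m j<m (↻⇒sameCycle σ↻ 0<∣σ∣)) j<m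

  classify : ∀ {σ} → σ ∈ avoiders → cls σ < m × σ ↻ Rep (cls σ)
  classify σ∈ with ∈avoiders⁻ σ∈
  ... | p , a with covered p a
  ...   | j , j<m , σ↻ = least-class j<m (nonempty p) σ↻

  sameCycle⇒cls : ∀ {σ τ} → T (sameCycle σ τ) → cls σ ≡ cls τ
  sameCycle⇒cls {σ} {τ} t = least-cong _ _ m λ j →
    mk⇔ (λ s → ↻⇒sameCycle (↻-trans (↻-sym σ↻τ) (sameCycle⇒↻ σ (Rep j) s)) 0<∣τ∣)
        (λ s → ↻⇒sameCycle (↻-trans σ↻τ (sameCycle⇒↻ τ (Rep j) s)) 0<∣σ∣)
    where
    σ↻τ : σ ↻ τ
    σ↻τ = sameCycle⇒↻ σ τ t
    0<∣σ∣ : 0 < length σ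
    0<∣σ∣ = sameCycle⇒nonempty σ τ t
    0<∣τ∣ : 0 < length τ
    0<∣τ∣ = subst (0 <_) (↻-length σ↻τ) 0<∣σ∣

  cls⇒sameCycle : ∀ {σ τ} → σ ∈ avoiders → τ ∈ avoiders → cls σ ≡ cls τ → T (sameCycle σ τ)
  cls⇒sameCycle σ∈ τ∈ e with classify σ∈ | classify τ∈
  ... | _ , σ↻ | _ , τ↻ rewrite e =
    ↻⇒sameCycle (↻-trans σ↻ (↻-sym τ↻)) (nonempty (proj₁ (∈avoiders⁻ σ∈)))

  onto : ∀ {j} → j < m → ∃ λ σ → σ ∈ avoiders × cls σ ≡ j
  onto {j} j<m with Rep-avoids j<m
  ... | p , a with least-class j<m (nonempty p) (↻-refl (Rep j))
  ...   | c<m , Rep↻ = Rep j , ∈avoiders⁺ p a , distinct c<m j<m (↻-sym Rep↻)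

-- Three-letter patterns and the staircases

Has : (ℕ → ℕ → ℕ → Set) → List ℕ → Set
Has R w = ∃[ x ] ∃[ y ] ∃[ z ] x ∷ y ∷ z ∷ [] ⊆ w × R x y z

-- The non-strict inequalities are what `<ᵇ ≡ false` yields; in a permutation they are strict.
Is132 Is213 Is231 : ℕ → ℕ → ℕ → Set
Is132 x y z = x < z × z ≤ y
Is213 x y z = y < x × x ≤ z
Is231 x y z = z < x × x < y

Has-⊆ : ∀ {R w w′} → w ⊆ w′ → Has R w → Has R w′
Has-⊆ w⊆ (x , y , z , h , r) = x , y , z , ⊆-trans h w⊆ , r

pair-⊆ : ∀ {x y w} → x ∈ w → y ∈ w → x ≢ y → x ∷ y ∷ [] ⊆ w ⊎ y ∷ x ∷ [] ⊆ w
pair-⊆ (here refl) (here refl) x≢y = ⊥-elim (x≢y refl)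
pair-⊆ (here refl) (there y∈) _ = inj₁ (refl ∷ from∈ y∈)
pair-⊆ (there x∈) (here refl) _ = inj₂ (refl ∷ from∈ x∈)
pair-⊆ {w = v ∷ _} (there x∈) (there y∈) x≢y with pair-⊆ x∈ y∈ x≢y
... | inj₁ p = inj₁ (v ∷ʳ p)
... | inj₂ p = inj₂ (v ∷ʳ p)

applyUpTo-increasing : ∀ f n {x y} → (∀ {i j} → i < j → f i < f j) → x ∷ y ∷ [] ⊆ applyUpTo f n → x < y
applyUpTo-increasing f (suc n) mono (_ ∷ʳ p) = applyUpTo-increasing (f ∘ suc) n (λ i<j → mono (s≤s i<j)) p
applyUpTo-increasing f (suc n) mono (refl ∷ p) with ∈-applyUpTo⁻ (f ∘ suc) (to∈ p)
... | i , _ , refl = mono (s≤s z≤n)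

upTo-increasing : ∀ n {x y} → x ∷ y ∷ [] ⊆ upTo n → x < y
upTo-increasing n = applyUpTo-increasing id n id

-- downUp m j = m−1, m−2, …, m−j, 0, 1, …, m−j−1 for j ≤ m.
downUp : ℕ → ℕ → List ℕ
downUp m zero = upTo m
downUp zero (suc j) = []
downUp (suc m) (suc j) = m ∷ downUp m j

downUp-IsPerm : ∀ m j → IsPerm m (downUp m j)
downUp-IsPerm m zero = ↭-refl
downUp-IsPerm zero (suc j) = ↭-refl
downUp-IsPerm (suc m) (suc j) = IsPerm-max∷ (downUp-IsPerm m j)

downUp-< : ∀ m j → All (_< m) (downUp m j)
downUp-< m j = All.tabulate (IsPerm-< (downUp-IsPerm m j))

downUp-injective : ∀ m {j k} → j < m → k < m → downUp m j ≡ downUp m k → j ≡ k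
downUp-injective (suc m) {zero} {zero} _ _ _ = refl
downUp-injective (suc m) {suc j} {suc k} (s≤s j<m) (s≤s k<m) e = cong suc (downUp-injective m j<m k<m (∷-injectiveʳ e))
downUp-injective (suc zero) {zero} {suc k} _ (s≤s ()) _
downUp-injective (suc (suc m)) {zero} {suc k} _ _ ()
downUp-injective (suc zero) {suc j} {zero} (s≤s ()) _ _
downUp-injective (suc (suc m)) {suc j} {zero} _ _ ()

¬Has132-downUp : ∀ m j → ¬ Has Is132 (downUp m j)
¬Has132-downUp m zero (x , y , z , h , _ , z≤y) = <⇒≱ (upTo-increasing m (∷ˡ⁻ h)) z≤y
¬Has132-downUp (suc m) (suc j) (x , y , z , _ ∷ʳ h , r) = ¬Has132-downUp m j (x , y , z , h , r)
¬Has132-downUp (suc m) (suc j) (x , y , z , refl ∷ h , x<z , _) with All-resp-⊆ h (downUp-< m j)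
... | _ ∷ z<m ∷ [] = <-asym x<z z<m

¬Has213-downUp : ∀ m j → ¬ Has Is213 (downUp m j)
¬Has213-downUp m zero (x , y , z , h , y<x , _) = <-asym (upTo-increasing m (⊆-trans (refl ∷ refl ∷ z ∷ʳ []) h)) y<x
¬Has213-downUp (suc m) (suc j) (x , y , z , _ ∷ʳ h , r) = ¬Has213-downUp m j (x , y , z , h , r)
¬Has213-downUp (suc m) (suc j) (x , y , z , refl ∷ h , _ , x≤z) with All-resp-⊆ h (downUp-< m j)
... | _ ∷ z<m ∷ [] = <⇒≱ z<m x≤z

¬Has231-downUp : ∀ m j → ¬ Has Is231 (downUp m j)
¬Has231-downUp m zero (x , y , z , h , z<x , x<y) = <-asym (upTo-increasing m (∷ˡ⁻ h)) (<-trans z<x x<y)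
¬Has231-downUp (suc m) (suc j) (x , y , z , _ ∷ʳ h , r) = ¬Has231-downUp m j (x , y , z , h , r)
¬Has231-downUp (suc m) (suc j) (x , y , z , refl ∷ h , _ , x<y) with All-resp-⊆ h (downUp-< m j)
... | y<m ∷ _ ∷ [] = <-asym x<y y<m

¬Has132⇒max-last : ∀ k p → IsPerm (suc (suc k)) (0 ∷ p) → ¬ Has Is132 (0 ∷ p) →
  ∃ λ p₁ → p ≡ p₁ ++ [ suc k ]
¬Has132⇒max-last k p σ↭ ¬132 with ∈-resp-↭ (↭-sym σ↭) (∈-upTo⁺ (n<1+n (suc k)))
... | there M∈p with ∈-∃++ M∈p
...   | p₁ , [] , refl = p₁ , refl
...   | p₁ , z ∷ p₂ , refl =
  ⊥-elim (¬132 (0 , suc k , z , refl ∷ ⊆-++⁺ˡ p₁ (refl ∷ refl ∷ minimum p₂) , 0<z , z≤M))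
  where
  z∈ : z ∈ p₁ ++ suc k ∷ z ∷ p₂
  z∈ = ∈-++⁺ʳ p₁ (there (here refl))
  0<z : 0 < z
  0<z with 0≢ ∷ _ ← IsPerm⇒Unique σ↭ = n≢0⇒n>0 (≢-sym (All.lookup 0≢ z∈))
  z≤M : z ≤ suc k
  z≤M = s≤s⁻¹ (IsPerm-< σ↭ (there z∈))

¬Has132⇒≡upTo : ∀ k p → IsPerm (suc k) (0 ∷ p) → ¬ Has Is132 (0 ∷ p) → 0 ∷ p ≡ upTo (suc k)
¬Has132⇒≡upTo zero p σ↭ _ = ↭-singleton-inv σ↭
¬Has132⇒≡upTo (suc k) p σ↭ ¬132 with ¬Has132⇒max-last k p σ↭ ¬132
... | p₁ , refl = begin
  0 ∷ p₁ ++ [ suc k ]         ≡⟨ cong (_++ [ suc k ]) 0∷p₁≡upTo ⟩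
  upTo (suc k) ++ [ suc k ]   ≡⟨ upTo-∷ʳ (suc k) ⟩
  upTo (suc (suc k))          ∎
  where
  open ≡-Reasoning
  p₁↭ : IsPerm (suc k) (0 ∷ p₁)
  p₁↭ = subst (IsPerm (suc k)) (++-identityʳ (0 ∷ p₁)) (IsPerm-delete-max (suc k) (0 ∷ p₁) σ↭)
  p₁⊆ : 0 ∷ p₁ ⊆ 0 ∷ p₁ ++ [ suc k ]
  p₁⊆ = ⊆-++⁺ʳ [ suc k ] ⊆-refl
  0∷p₁≡upTo : 0 ∷ p₁ ≡ upTo (suc k)
  0∷p₁≡upTo = ¬Has132⇒≡upTo k p₁ p₁↭ (¬132 ∘ Has-⊆ p₁⊆)

avoiders-are-downUp : ∀ m w → IsPerm (suc m) w →
  ¬ Has Is132 w → ¬ Has Is213 w → ¬ Has Is231 w → ∃ λ j → j < suc m × w ≡ downUp (suc m) j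
avoiders-are-downUp zero w w↭ _ _ _ = 0 , s≤s z≤n , ↭-singleton-inv w↭
avoiders-are-downUp (suc m) [] w↭ _ _ _ with () ← IsPerm-length w↭
avoiders-are-downUp (suc m) (x ∷ w) x∷w↭ ¬132 ¬213 ¬231 with x ≟ suc m | x ≟ 0
... | yes refl | _
  with avoiders-are-downUp m w (IsPerm-delete-max (suc m) [] x∷w↭)
         (¬132 ∘ Has-⊆ (x ∷ʳ ⊆-refl)) (¬213 ∘ Has-⊆ (x ∷ʳ ⊆-refl)) (¬231 ∘ Has-⊆ (x ∷ʳ ⊆-refl))
...   | j , j<m , refl = suc j , s≤s j<m , refl
avoiders-are-downUp (suc m) (x ∷ w) x∷w↭ ¬132 _ _ | no _ | yes refl =
  0 , s≤s z≤n , ¬Has132⇒≡upTo (suc m) w x∷w↭ ¬132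
avoiders-are-downUp (suc m) (x ∷ w) x∷w↭ _ ¬213 ¬231 | no x≢M | no x≢0
  with ∈-resp-↭ (↭-sym x∷w↭) (∈-upTo⁺ {i = 0} (s≤s z≤n))
     | ∈-resp-↭ (↭-sym x∷w↭) (∈-upTo⁺ (n<1+n (suc m)))
... | here 0≡x | _ = ⊥-elim (x≢0 (sym 0≡x))
... | _ | here M≡x = ⊥-elim (x≢M (sym M≡x))
... | there 0∈w | there M∈w with pair-⊆ 0∈w M∈w (λ ())
...   | inj₁ 0M⊆ =
  ⊥-elim (¬213 (x , 0 , suc m , refl ∷ 0M⊆ , n≢0⇒n>0 x≢0 , s≤s⁻¹ (IsPerm-< x∷w↭ (here refl))))
...   | inj₂ M0⊆ =
  ⊥-elim (¬231 (x , suc m , 0 , refl ∷ M0⊆ , n≢0⇒n>0 x≢0 , ≤∧≢⇒< (s≤s⁻¹ (IsPerm-< x∷w↭ (here refl))) x≢M))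

-- Moving the maximum to the front

π1243 π1324 π1342 π1423 : List ℕ
π1243 = 1 ∷ 2 ∷ 4 ∷ 3 ∷ []
π1324 = 1 ∷ 3 ∷ 2 ∷ 4 ∷ []
π1342 = 1 ∷ 3 ∷ 4 ∷ 2 ∷ []
π1423 = 1 ∷ 4 ∷ 2 ∷ 3 ∷ []

OrderIso-shape₄ : ∀ Y {a b c d} → OrderIso Y (a ∷ b ∷ c ∷ d ∷ []) →
  ∃[ y₁ ] ∃[ y₂ ] ∃[ y₃ ] ∃[ y₄ ] Y ≡ y₁ ∷ y₂ ∷ y₃ ∷ y₄ ∷ []
OrderIso-shape₄ (y₁ ∷ y₂ ∷ y₃ ∷ y₄ ∷ []) _ = y₁ , y₂ , y₃ , y₄ , refl
OrderIso-shape₄ [] ()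
OrderIso-shape₄ (_ ∷ []) (() , _)
OrderIso-shape₄ (_ ∷ _ ∷ []) ((_ , ()) , _)
OrderIso-shape₄ (_ ∷ _ ∷ _ ∷ []) ((_ , _ , ()) , _)
OrderIso-shape₄ (_ ∷ _ ∷ _ ∷ _ ∷ _ ∷ _) ((_ , _ , _ , ()) , _)

↻-shape₄ : ∀ {X y₁ y₂ y₃ y₄} → X ↻ y₁ ∷ y₂ ∷ y₃ ∷ y₄ ∷ [] →
    X ≡ y₁ ∷ y₂ ∷ y₃ ∷ y₄ ∷ [] ⊎ X ≡ y₂ ∷ y₃ ∷ y₄ ∷ y₁ ∷ []
  ⊎ X ≡ y₃ ∷ y₄ ∷ y₁ ∷ y₂ ∷ [] ⊎ X ≡ y₄ ∷ y₁ ∷ y₂ ∷ y₃ ∷ []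
↻-shape₄ (a , [] , refl , refl) = inj₁ (++-identityʳ a)
↻-shape₄ (a , _ ∷ [] , refl , refl) = inj₂ (inj₁ refl)
↻-shape₄ (a , _ ∷ _ ∷ [] , refl , refl) = inj₂ (inj₂ (inj₁ refl))
↻-shape₄ (a , _ ∷ _ ∷ _ ∷ [] , refl , refl) = inj₂ (inj₂ (inj₂ refl))
↻-shape₄ (a , _ ∷ _ ∷ _ ∷ _ ∷ [] , refl , refl) = inj₁ refl

-- An occurrence using M must use it as the 4: in any other role some entry of w would exceed M.
MaxSplits : List ℕ → (ℕ → ℕ → ℕ → Set) → Set
MaxSplits π R = ∀ {M w} → All (_< M) w → CycContains (M ∷ w) π → Has R w ⊎ CycContains w π

MaxJoins : List ℕ → (ℕ → ℕ → ℕ → Set) → Set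
MaxJoins π R = ∀ {M w} → All (_< M) w → Has R w → CycContains (M ∷ w) π

maxSplits-1324 : MaxSplits π1324 Is132
maxSplits-1324 _ (X , Y , _ ∷ʳ h , r , t) = inj₂ (X , Y , h , r , t)
maxSplits-1324 bd (_ ∷ _ , Y , refl ∷ h , r , t) with orderIso⇒OrderIso Y π1324 t
... | iso with OrderIso-shape₄ Y iso
... | y₁ , y₂ , y₃ , y₄ , refl with iso | ↻-shape₄ r | All-resp-⊆ h bd
... | (e₁₂ , _ , _ , _) , _ , _ , _ | inj₁ refl | y₂<y₁ ∷ _ =
  ⊥-elim (<-asym (<ᵇ≡true⇒< e₁₂) y₂<y₁)
... | _ , (_ , e₂₄ , _) , _ , _ | inj₂ (inj₁ refl) | _ ∷ y₄<y₂ ∷ _ =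
  ⊥-elim (<-asym (<ᵇ≡true⇒< e₂₄) y₄<y₂)
... | _ , _ , (e₃₄ , _) , _ | inj₂ (inj₂ (inj₁ refl)) | y₄<y₃ ∷ _ =
  ⊥-elim (<-asym (<ᵇ≡true⇒< e₃₄) y₄<y₃)
... | (_ , e₁₃ , _ , _) , (e₂₃ , _ , _) , _ , _ | inj₂ (inj₂ (inj₂ refl)) | _ =
  inj₁ (y₁ , y₂ , y₃ , h , <ᵇ≡true⇒< e₁₃ , <ᵇ≡false⇒≥ e₂₃)

maxSplits-1342 : MaxSplits π1342 Is213
maxSplits-1342 _ (X , Y , _ ∷ʳ h , r , t) = inj₂ (X , Y , h , r , t)
maxSplits-1342 bd (_ ∷ _ , Y , refl ∷ h , r , t) with orderIso⇒OrderIso Y π1342 t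
... | iso with OrderIso-shape₄ Y iso
... | y₁ , y₂ , y₃ , y₄ , refl with iso | ↻-shape₄ r | All-resp-⊆ h bd
... | (e₁₂ , _ , _ , _) , _ , _ , _ | inj₁ refl | y₂<y₁ ∷ _ =
  ⊥-elim (<-asym (<ᵇ≡true⇒< e₁₂) y₂<y₁)
... | _ , (e₂₃ , _ , _) , _ , _ | inj₂ (inj₁ refl) | y₃<y₂ ∷ _ =
  ⊥-elim (<-asym (<ᵇ≡true⇒< e₂₃) y₃<y₂)
... | (_ , _ , e₁₄ , _) , (_ , e₂₄ , _) , _ , _ | inj₂ (inj₂ (inj₁ refl)) | _ =
  inj₁ (y₄ , y₁ , y₂ , h , <ᵇ≡true⇒< e₁₄ , <ᵇ≡false⇒≥ e₂₄)
... | _ , (_ , e₂₄ , _) , _ , _ | inj₂ (inj₂ (inj₂ refl)) | _ ∷ y₂<y₄ ∷ _ =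
  ⊥-elim (<⇒≱ y₂<y₄ (<ᵇ≡false⇒≥ e₂₄))

maxSplits-1423 : MaxSplits π1423 Is231
maxSplits-1423 _ (X , Y , _ ∷ʳ h , r , t) = inj₂ (X , Y , h , r , t)
maxSplits-1423 bd (_ ∷ _ , Y , refl ∷ h , r , t) with orderIso⇒OrderIso Y π1423 t
... | iso with OrderIso-shape₄ Y iso
... | y₁ , y₂ , y₃ , y₄ , refl with iso | ↻-shape₄ r | All-resp-⊆ h bd
... | (e₁₂ , _ , _ , _) , _ , _ , _ | inj₁ refl | y₂<y₁ ∷ _ =
  ⊥-elim (<-asym (<ᵇ≡true⇒< e₁₂) y₂<y₁)
... | (_ , e₁₃ , _ , _) , _ , (e₃₄ , _) , _ | inj₂ (inj₁ refl) | _ =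
  inj₁ (y₃ , y₄ , y₁ , h , <ᵇ≡true⇒< e₁₃ , <ᵇ≡true⇒< e₃₄)
... | _ , _ , (e₃₄ , _) , _ | inj₂ (inj₂ (inj₁ refl)) | y₄<y₃ ∷ _ =
  ⊥-elim (<-asym (<ᵇ≡true⇒< e₃₄) y₄<y₃)
... | _ , (_ , e₂₄ , _) , _ , _ | inj₂ (inj₂ (inj₂ refl)) | _ ∷ y₂<y₄ ∷ _ =
  ⊥-elim (<⇒≱ y₂<y₄ (<ᵇ≡false⇒≥ e₂₄))

maxJoins-1324 : MaxJoins π1324 Is132
maxJoins-1324 {M} bd (x , y , z , h , x<z , z≤y) with All-resp-⊆ h bd
... | x<M ∷ y<M ∷ z<M ∷ [] =
  M ∷ x ∷ y ∷ z ∷ [] , x ∷ y ∷ z ∷ M ∷ [] , refl ∷ h , (M ∷ [] , x ∷ y ∷ z ∷ [] , refl , refl) ,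
  OrderIso⇒orderIso (x ∷ y ∷ z ∷ M ∷ []) π1324
    ( (<⇒<ᵇ≡true (<-≤-trans x<z z≤y) , <⇒<ᵇ≡true x<z , <⇒<ᵇ≡true x<M , tt)
    , (≥⇒<ᵇ≡false z≤y , <⇒<ᵇ≡true y<M , tt) , (<⇒<ᵇ≡true z<M , tt) , tt , tt)

maxJoins-1342 : MaxJoins π1342 Is213
maxJoins-1342 {M} bd (x , y , z , h , y<x , x≤z) with All-resp-⊆ h bd
... | x<M ∷ y<M ∷ z<M ∷ [] =
  M ∷ x ∷ y ∷ z ∷ [] , y ∷ z ∷ M ∷ x ∷ [] , refl ∷ h , (M ∷ x ∷ [] , y ∷ z ∷ [] , refl , refl) ,
  OrderIso⇒orderIso (y ∷ z ∷ M ∷ x ∷ []) π1342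
    ( (<⇒<ᵇ≡true (<-≤-trans y<x x≤z) , <⇒<ᵇ≡true y<M , <⇒<ᵇ≡true y<x , tt)
    , (<⇒<ᵇ≡true z<M , ≥⇒<ᵇ≡false x≤z , tt) , (≥⇒<ᵇ≡false (<⇒≤ x<M) , tt) , tt , tt)

maxJoins-1423 : MaxJoins π1423 Is231
maxJoins-1423 {M} bd (x , y , z , h , z<x , x<y) with All-resp-⊆ h bd
... | x<M ∷ y<M ∷ z<M ∷ [] =
  M ∷ x ∷ y ∷ z ∷ [] , z ∷ M ∷ x ∷ y ∷ [] , refl ∷ h , (M ∷ x ∷ y ∷ [] , z ∷ [] , refl , refl) ,
  OrderIso⇒orderIso (z ∷ M ∷ x ∷ y ∷ []) π1423
    ( (<⇒<ᵇ≡true z<M , <⇒<ᵇ≡true z<x , <⇒<ᵇ≡true (<-trans z<x x<y) , tt)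
    , (≥⇒<ᵇ≡false (<⇒≤ x<M) , ≥⇒<ᵇ≡false (<⇒≤ y<M) , tt) , (<⇒<ᵇ≡true x<y , tt) , tt , tt)

¬CycContains-[] : ∀ {π} → π ≢ [] → ¬ CycContains [] π
¬CycContains-[] π≢[] ([] , Y , [] , r , t) = <⇒≢ (orderIso-nonempty Y π≢[] t) (↻-length r)

downUp-¬CycContains : ∀ {π R} → π ≢ [] → MaxSplits π R → (∀ m j → ¬ Has R (downUp m j)) →
  ∀ m j → ¬ CycContains (downUp m j) π
downUp-¬CycContains π≢[] split ¬R zero zero = ¬CycContains-[] π≢[]
downUp-¬CycContains π≢[] split ¬R zero (suc j) = ¬CycContains-[] π≢[]
downUp-¬CycContains π≢[] split ¬R (suc m) (suc j) c with split (downUp-< m j) c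
... | inj₁ h = ¬R m j h
... | inj₂ c′ = downUp-¬CycContains π≢[] split ¬R m j c′
downUp-¬CycContains π≢[] split ¬R (suc m) zero c with split (downUp-< m zero) (CycContains-↻ upTo↻ c)
  where
  upTo↻ : upTo (suc m) ↻ m ∷ upTo m
  upTo↻ = upTo m , [ m ] , sym (upTo-∷ʳ m) , refl
... | inj₁ h = ¬R m zero h
... | inj₂ c′ = downUp-¬CycContains π≢[] split ¬R m zero c′

-- The two avoidance classes

ΠA ΠB : List (List ℕ)
ΠA = π1243 ∷ π1324 ∷ π1423 ∷ []
ΠB = π1324 ∷ π1342 ∷ π1423 ∷ []

Avoids-ΠB-downUp : ∀ m j → Avoids ΠB (downUp m j)
Avoids-ΠB-downUp m j =
    downUp-¬CycContains (λ ()) maxSplits-1324 ¬Has132-downUp m j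
  ∷ downUp-¬CycContains (λ ()) maxSplits-1342 ¬Has213-downUp m j
  ∷ downUp-¬CycContains (λ ()) maxSplits-1423 ¬Has231-downUp m j
  ∷ []

∷↻∷⇒≡ : ∀ {x u v} → Unique (x ∷ u) → x ∷ u ↻ x ∷ v → u ≡ v
∷↻∷⇒≡ {u = u} _ ([] , _ , refl , refl) = sym (++-identityʳ u)
∷↻∷⇒≡ _ (_ ∷ a , [] , refl , refl) = ++-identityʳ a
∷↻∷⇒≡ (x≢u ∷ _) (_ ∷ a , _ ∷ b , refl , refl) = ⊥-elim (All.lookup x≢u (∈-++⁺ʳ a (here refl)) refl)

ΠB-rep : ℕ → ℕ → List ℕ
ΠB-rep k j = downUp (suc (suc k)) (suc j)

ΠB-covered : ∀ k {σ} → IsPerm (suc (suc k)) σ → Avoids ΠB σ → ∃ λ j → j < suc k × σ ↻ ΠB-rep k j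
ΠB-covered k σ↭ (¬1324 ∷ ¬1342 ∷ ¬1423 ∷ [])
  with ∈-∃++ (∈-resp-↭ (↭-sym σ↭) (∈-upTo⁺ (n<1+n (suc k))))
... | a , b , refl
  with avoiders-are-downUp k (b ++ a) w↭
         (¬max∷ ¬1324 maxJoins-1324) (¬max∷ ¬1342 maxJoins-1342) (¬max∷ ¬1423 maxJoins-1423)
  where
  w↭ : IsPerm (suc k) (b ++ a)
  w↭ = IsPerm-↻ (a , b , refl , refl) (IsPerm-delete-max (suc k) a σ↭)
  ¬max∷ : ∀ {π R} → ¬ CycContains (a ++ suc k ∷ b) π → MaxJoins π R → ¬ Has R (b ++ a)
  ¬max∷ ¬c join h = ¬c (CycContains-↻ (suc k ∷ b , a , refl , refl) (join (All.tabulate (IsPerm-< w↭)) h))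
... | j , j<1+k , b++a≡ =
  j , j<1+k , subst (λ w → a ++ suc k ∷ b ↻ suc k ∷ w) b++a≡ (a , suc k ∷ b , refl , refl)

ΠB-rep-distinct : ∀ k {i j} → i < suc k → j < suc k → ΠB-rep k i ↻ ΠB-rep k j → i ≡ j
ΠB-rep-distinct k {i} i<1+k j<1+k r =
  downUp-injective (suc k) i<1+k j<1+k (∷↻∷⇒≡ (IsPerm⇒Unique (downUp-IsPerm (suc (suc k)) (suc i))) r)

numAv-ΠB : ∀ k → numAv ΠB (suc (suc k)) ≡ suc k
numAv-ΠB k = numAv-representatives ΠB (suc (suc k)) (suc k) (ΠB-rep k)
  ((λ ()) ∷ (λ ()) ∷ (λ ()) ∷ []) (s≤s z≤n)
  (λ {j} _ → downUp-IsPerm (suc (suc k)) (suc j) , Avoids-ΠB-downUp (suc (suc k)) (suc j))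
  (ΠB-covered k) (ΠB-rep-distinct k)

<ᵇ-flip : ∀ {x y} → x ≢ y → (y <ᵇ x) ≡ not (x <ᵇ y)
<ᵇ-flip {x} {y} x≢y with x <ᵇ y in e₁ | y <ᵇ x in e₂
... | true  | true  = ⊥-elim (<-asym (<ᵇ≡true⇒< {x} e₁) (<ᵇ≡true⇒< {y} e₂))
... | true  | false = refl
... | false | true  = refl
... | false | false = ⊥-elim (x≢y (≤-antisym (<ᵇ≡false⇒≥ {y} e₂) (<ᵇ≡false⇒≥ {x} e₁)))

<ᵇ-flip-≡ : ∀ {x y p q} → x ≢ y → p ≢ q → (x <ᵇ y) ≡ (p <ᵇ q) → (y <ᵇ x) ≡ (q <ᵇ p)
<ᵇ-flip-≡ {x} {y} {p} {q} x≢y p≢q e =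
  trans (<ᵇ-flip {x} {y} x≢y) (trans (cong not e) (sym (<ᵇ-flip {p} {q} p≢q)))

-- Reversal flips every comparison not involving p₁, which needs distinct entries.
CycContains-reverse : ∀ {σ p₁ p₂ p₃ p₄} → Unique σ → p₂ ≢ p₃ → p₂ ≢ p₄ → p₃ ≢ p₄ →
  CycContains σ (p₁ ∷ p₂ ∷ p₃ ∷ p₄ ∷ []) → CycContains (reverse σ) (p₁ ∷ p₄ ∷ p₃ ∷ p₂ ∷ [])
CycContains-reverse {p₁ = p₁} {p₂} {p₃} {p₄} σ! p₂≢p₃ p₂≢p₄ p₃≢p₄ (X , Y , X⊆σ , X↻Y , t)
  with orderIso⇒OrderIso Y _ t
... | iso with OrderIso-shape₄ Y iso
... | a , b , c , d , refl
  with iso | Unique-resp-↭ (↭⇒↭ₛ (↻⇒↭ X↻Y)) (Unique-⊆ X⊆σ σ!)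
... | (e₁₂ , e₁₃ , e₁₄ , _) , (e₂₃ , e₂₄ , _) , (e₃₄ , _) , _ | _ ∷ (b≢c ∷ b≢d ∷ []) ∷ (c≢d ∷ []) ∷ _ =
  reverse X , a ∷ d ∷ c ∷ b ∷ [] , ⊆-reverse⁺ X⊆σ ,
  ↻-trans (↻-reverse X↻Y) (d ∷ c ∷ b ∷ [] , a ∷ [] , refl , refl) ,
  OrderIso⇒orderIso (a ∷ d ∷ c ∷ b ∷ []) (p₁ ∷ p₄ ∷ p₃ ∷ p₂ ∷ [])
    ( (e₁₄ , e₁₃ , e₁₂ , tt)
    , (<ᵇ-flip-≡ c≢d p₃≢p₄ e₃₄ , <ᵇ-flip-≡ b≢d p₂≢p₄ e₂₄ , tt)
    , (<ᵇ-flip-≡ b≢c p₂≢p₃ e₂₃ , tt) , tt , tt)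

reverse-CycContains : ∀ {σ p₁ p₂ p₃ p₄} → Unique (reverse σ) → p₂ ≢ p₃ → p₂ ≢ p₄ → p₃ ≢ p₄ →
  CycContains (reverse σ) (p₁ ∷ p₂ ∷ p₃ ∷ p₄ ∷ []) → CycContains σ (p₁ ∷ p₄ ∷ p₃ ∷ p₂ ∷ [])
reverse-CycContains {σ} r! p₂≢p₃ p₂≢p₄ p₃≢p₄ c =
  subst (λ τ → CycContains τ _) (reverse-involutive σ) (CycContains-reverse r! p₂≢p₃ p₂≢p₄ p₃≢p₄ c)

Avoids-ΠB⇒Avoids-ΠA-reverse : ∀ {n σ} → IsPerm n σ → Avoids ΠB σ → Avoids ΠA (reverse σ)
Avoids-ΠB⇒Avoids-ΠA-reverse {σ = σ} σ↭ (¬1324 ∷ ¬1342 ∷ ¬1423 ∷ []) =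
    (¬1342 ∘ reverse-CycContains r! (λ ()) (λ ()) (λ ()))
  ∷ (¬1423 ∘ reverse-CycContains r! (λ ()) (λ ()) (λ ()))
  ∷ (¬1324 ∘ reverse-CycContains r! (λ ()) (λ ()) (λ ()))
  ∷ []
  where
  r! : Unique (reverse σ)
  r! = IsPerm⇒Unique (IsPerm-reverse σ↭)

Avoids-ΠA⇒Avoids-ΠB-reverse : ∀ {n σ} → IsPerm n σ → Avoids ΠA σ → Avoids ΠB (reverse σ)
Avoids-ΠA⇒Avoids-ΠB-reverse {σ = σ} σ↭ (¬1243 ∷ ¬1324 ∷ ¬1423 ∷ []) =
    (¬1423 ∘ reverse-CycContains r! (λ ()) (λ ()) (λ ()))
  ∷ (¬1243 ∘ reverse-CycContains r! (λ ()) (λ ()) (λ ()))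
  ∷ (¬1324 ∘ reverse-CycContains r! (λ ()) (λ ()) (λ ()))
  ∷ []
  where
  r! : Unique (reverse σ)
  r! = IsPerm⇒Unique (IsPerm-reverse σ↭)

ΠA-covered : ∀ k {σ} → IsPerm (suc (suc k)) σ → Avoids ΠA σ →
  ∃ λ j → j < suc k × σ ↻ reverse (ΠB-rep k j)
ΠA-covered k {σ} σ↭ av with ΠB-covered k (IsPerm-reverse σ↭) (Avoids-ΠA⇒Avoids-ΠB-reverse σ↭ av)
... | j , j<1+k , r = j , j<1+k , subst (_↻ reverse (ΠB-rep k j)) (reverse-involutive σ) (↻-reverse r)

numAv-ΠA : ∀ k → numAv ΠA (suc (suc k)) ≡ suc k
numAv-ΠA k = numAv-representatives ΠA (suc (suc k)) (suc k) (reverse ∘ ΠB-rep k)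
  ((λ ()) ∷ (λ ()) ∷ (λ ()) ∷ []) (s≤s z≤n)
  (λ {j} _ → IsPerm-reverse (rep↭ j) ,
             Avoids-ΠB⇒Avoids-ΠA-reverse (rep↭ j) (Avoids-ΠB-downUp (suc (suc k)) (suc j)))
  (ΠA-covered k)
  (λ i<1+k j<1+k r → ΠB-rep-distinct k i<1+k j<1+k (↻-reverse⁻ r))
  where
  rep↭ : ∀ j → IsPerm (suc (suc k)) (ΠB-rep k j)
  rep↭ j = downUp-IsPerm (suc (suc k)) (suc j)

mainTheorem14 :
  ((n : ℕ) →
    numAv ((1 ∷ 2 ∷ 4 ∷ 3 ∷ []) ∷ (1 ∷ 3 ∷ 2 ∷ 4 ∷ []) ∷ (1 ∷ 4 ∷ 2 ∷ 3 ∷ []) ∷ []) n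
      ≡ numAv ((1 ∷ 3 ∷ 2 ∷ 4 ∷ []) ∷ (1 ∷ 3 ∷ 4 ∷ 2 ∷ []) ∷ (1 ∷ 4 ∷ 2 ∷ 3 ∷ []) ∷ []) n)
  × ((n : ℕ) → 2 ≤ n →
    numAv ((1 ∷ 3 ∷ 2 ∷ 4 ∷ []) ∷ (1 ∷ 3 ∷ 4 ∷ 2 ∷ []) ∷ (1 ∷ 4 ∷ 2 ∷ 3 ∷ []) ∷ []) n ≡ n ∸ 1)
mainTheorem14 = equinumerous , numAv-ΠB≡n∸1
  where
  equinumerous : ∀ n → numAv ΠA n ≡ numAv ΠB n
  equinumerous zero = refl
  equinumerous (suc zero) = refl
  equinumerous (suc (suc k)) = trans (numAv-ΠA k) (sym (numAv-ΠB k))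
  numAv-ΠB≡n∸1 : ∀ n → 2 ≤ n → numAv ΠB n ≡ n ∸ 1
  numAv-ΠB≡n∸1 (suc (suc k)) _ = numAv-ΠB k
  numAv-ΠB≡n∸1 (suc zero) (s≤s ())
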